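{- Let $k,\ell$ be positive integers and put $v=\frac{\ell(\ell-2)k}{(\ell-1)^2-k}$. If there exists a resolvable $\left(\frac{(\ell-2)k}{(\ell-1)^2-k}, \frac{k}{\ell-1}, \frac{(\ell-1)^2-k}{\ell-1}\right)$-BIBD and $\lambda$ is a positive integer multiple of $\frac{k((\ell-1)^2-k)}{(\ell-1)^2}$, then there exists a $(v,k,\lambda)$-BIBD admitting a $0$-ULSE $\ell$-colouring. In particular, if such a resolvable BIBD exists, then there exists a symmetric $(v,k,\lambda)$-BIBD (with $\lambda=\frac{k((\ell-1)^2-k)}{(\ell-1)^2}$) admitting a $0$-ULSE $\ell$-colouring.
   Context: For positive integers $v,k,\lambda$ with $2\le k<v$, a $(v,k,\lambda)$-BIBD is a pair $(V,\mathcal{B})$ where $V$ is a set of $v$ points and $\mathcal{B}$ is a collection of $k$-element subsets of $V$ (blocks) such that every pair of distinct points lies in exactly $\lambda$ blocks. It is symmetric if it has exactly $v$ blocks. A BIBD is resolvable if its blocks can be partitioned into resolution classes, each of which is a partition of $V$. An $\ell$-colouring is a surjective map from $V$ onto a set of $\ell$ colours. A $0$-ULSE $\ell$-colouring is an $\ell$-colouring such that $(\ell-1)$ divides $k$ and in every block exactly one colour does not appear, while each of the other $\ell-1$ colours appears exactly $\frac{k}{\ell-1}$ times in that block. -}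

module Defs where

open import Data.Nat using (ℕ; zero; suc; _+_; _*_; _∸_; _≤_; _<_)
open import Data.Bool using (Bool; true; false; _∧_)
open import Data.Fin using (Fin; _≟_)
open import Data.Fin.Subset using (Subset; ∣_∣; _∩_)
open import Data.Vec using (lookup; tabulate)
open import Data.List using (List; length; filterᵇ; concat)
open import Data.List.Relation.Unary.All using (All)
open import Data.List.Relation.Binary.Permutation.Propositional using (_↭_)
open import Data.Product using (Σ; ∃; _×_)
open import Data.Nat.Divisibility using (_∣_)
open import Function.Definitions using (Surjective)
open import Relation.Binary.PropositionalEquality using (_≡_; _≢_)
open import Relation.Nullary.Decidable using (⌊_⌋)

-- Blocks are subsets of the point set Fin v; the block collection is a
-- list (a multiset: repeated blocks are allowed).

pairCount : {v : ℕ} → List (Subset v) → Fin v → Fin v → ℕ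
pairCount bs x y = length (filterᵇ (λ B → lookup B x ∧ lookup B y) bs)

pointCount : {v : ℕ} → List (Subset v) → Fin v → ℕ
pointCount bs x = length (filterᵇ (λ B → lookup B x) bs)

record BIBD (v k lam : ℕ) : Set where
  field
    blocks    : List (Subset v)
    v-pos     : 1 ≤ v
    lam-pos   : 1 ≤ lam
    k≥2       : 2 ≤ k
    k<v       : k < v
    blockSize : All (λ B → ∣ B ∣ ≡ k) blocks
    balanced  : (x y : Fin v) → x ≢ y → pairCount blocks x y ≡ lam
open BIBD public

-- a partition of the point set: every point lies in exactly one block of
-- the class (blocks are nonempty since k ≥ 2)
IsPartition : {v : ℕ} → List (Subset v) → Set
IsPartition {v} cls = (x : Fin v) → pointCount cls x ≡ 1

Resolvable : {v k lam : ℕ} → BIBD v k lam → Set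
Resolvable {v} D =
  Σ (List (List (Subset v))) λ classes →
    (concat classes ↭ blocks D) × All IsPartition classes

Symmetric : {v k lam : ℕ} → BIBD v k lam → Set
Symmetric {v} D = length (blocks D) ≡ v

colourClass : {v ℓ : ℕ} → (Fin v → Fin ℓ) → Fin ℓ → Subset v
colourClass c i = tabulate (λ x → ⌊ c x ≟ i ⌋)

colourCount : {v ℓ : ℕ} → (Fin v → Fin ℓ) → Subset v → Fin ℓ → ℕ
colourCount c B i = ∣ B ∩ colourClass c i ∣

IsColouring : {v ℓ : ℕ} → (Fin v → Fin ℓ) → Set
IsColouring c = Surjective _≡_ _≡_ c

-- 0-ULSE ℓ-colouring: (ℓ-1) ∣ k and in every block exactly one colour j is
-- missing while every other colour appears exactly k/(ℓ-1) times
-- (written as  count * (ℓ-1) ≡ k,  which is the same as count ≡ k/(ℓ-1)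
-- given (ℓ-1) ∣ k and ℓ ≥ 2).
ZeroULSE : {v k lam : ℕ} (ℓ : ℕ) → BIBD v k lam → (Fin v → Fin ℓ) → Set
ZeroULSE {v} {k} ℓ D c =
  IsColouring c × ((ℓ ∸ 1) ∣ k) ×
  All (λ B → Σ (Fin ℓ) λ j →
          (colourCount c B j ≡ 0) ×
          ((i : Fin ℓ) → i ≢ j → colourCount c B i * (ℓ ∸ 1) ≡ k))
      (blocks D)

module Submission where

-- Write L = ℓ - 1. The hypotheses force k₀ + λ₀ = L, and the resolvable design has r = L
-- parallel classes of n blocks with n λ₀ = L - 1, so it is affine: by Bose's variance count,
-- blocks of distinct classes meet in exactly k₀ / n points. Take ℓ colours, each carrying a
-- copy of the small point set, and for every colour j and small point p the block that on
-- colour i is the block through p of the parallel class numbered i - j (mod ℓ), empty for i = j.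
-- It has r k₀ = k points, k₀ of every colour except j. Two points of one colour share λ₀ k₀
-- such blocks by the concurrence of the small design; two points of different colours share
-- (ℓ - 2) k₀ / n = λ₀ k₀ of them by the affine intersection property. These ℓ v₀ = v blocks
-- form a symmetric design, and repeating them m times gives λ = m λ₀ k₀.

open import Defs
open import Data.Nat using (ℕ; _+_; _*_; _∸_; _^_; _≤_)
open import Data.Fin using (Fin)
open import Data.Product using (Σ; _×_)
open import Relation.Binary.PropositionalEquality using (_≡_)

open import Data.Bool using (Bool; true; false; _∧_; not)
open import Data.Bool.Properties using (∧-zeroʳ)
open import Data.Empty using (⊥; ⊥-elim)
open import Data.Fin as Fin using (zero; suc; _≟_; _↑ˡ_; _↑ʳ_; combine; remQuot)
open import Data.Fin.Permutation using (permutation)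
open import Data.Fin.Properties as Finₚ
  using (nonZeroIndex; toℕ<n; toℕ-fromℕ<; toℕ-injective; remQuot-combine; combine-remQuot)
open import Data.Fin.Subset using (Subset; ∣_∣; _∩_)
open import Data.List as List using (List; []; _∷_; _++_; length; filterᵇ; concat)
open import Data.List.Membership.Propositional.Properties using (∈-lookup)
open import Data.List.Properties using (filter-++; length-++; length-tabulate; tabulate-lookup)
open import Data.List.Relation.Binary.Permutation.Propositional using (_↭_; ↭-sym)
open import Data.List.Relation.Binary.Permutation.Propositional.Properties using (↭-length; filter-↭; All-resp-↭)
open import Data.List.Relation.Unary.All as All using (All)
open import Data.List.Relation.Unary.All.Properties using (concat⁺; concat⁻; tabulate⁺)
open import Data.Nat as ℕ using (zero; suc; _<_; z≤n; s≤s; ∣_-_∣; NonZero; >-nonZero)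
open import Data.Nat.DivMod using (_/_; m*n/n≡m)
open import Data.Nat.Divisibility using (divides)
open import Data.Nat.Properties hiding (_≟_)
open import Algebra.Properties.Semiring.Sum +-*-semiring
  using (sum; sum-cong-≗; ∑-distrib-+; ∑-comm; sum-permute; *-distribˡ-sum; *-distribʳ-sum)
open import Data.Nat.Tactic.RingSolver using (solve-∀)
open import Data.Product using (_,_; proj₁; proj₂; uncurry)
open import Data.Sum using (_⊎_; inj₁; inj₂; [_,_]′)
open import Data.Vec as Vec using ([]; _∷_)
open import Data.Vec.Properties using (lookup∘tabulate; lookup-zipWith)
open import Function using (_∘_; id)
open import Relation.Binary.PropositionalEquality
  using (refl; sym; trans; cong; cong₂; subst; _≢_; module ≡-Reasoning)
open import Relation.Nullary using (Dec; yes; no; does; contradiction)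
open import Relation.Nullary.Decidable using (⌊_⌋; T?; isYes≗does)

open ≡-Reasoning

⟦_⟧ : Bool → ℕ
⟦ true ⟧  = 1
⟦ false ⟧ = 0

δ : ∀ {n} → Fin n → Fin n → ℕ
δ i j = ⟦ does (i ≟ j) ⟧

δᶜ : ∀ {n} → Fin n → Fin n → ℕ
δᶜ i j = ⟦ not (does (i ≟ j)) ⟧

⟦∧⟧ : ∀ a b → ⟦ a ∧ b ⟧ ≡ ⟦ a ⟧ * ⟦ b ⟧
⟦∧⟧ true  b = sym (+-identityʳ ⟦ b ⟧)
⟦∧⟧ false b = refl

⟦⟧-idem : ∀ b → ⟦ b ⟧ * ⟦ b ⟧ ≡ ⟦ b ⟧
⟦⟧-idem true  = refl
⟦⟧-idem false = refl

δ-refl : ∀ {n} (i : Fin n) → δ i i ≡ 1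
δ-refl i with i ≟ i
... | yes _   = refl
... | no i≢i = contradiction refl i≢i

δ-≢ : ∀ {n} {i j : Fin n} → i ≢ j → δ i j ≡ 0
δ-≢ {i = i} {j} i≢j with i ≟ j
... | yes i≡j = contradiction i≡j i≢j
... | no _    = refl

δᶜ-≡ : ∀ {n} {i j : Fin n} → i ≡ j → δᶜ i j ≡ 0
δᶜ-≡ {i = i} refl with i ≟ i
... | yes _   = refl
... | no i≢i = contradiction refl i≢i

δᶜ-≢ : ∀ {n} {i j : Fin n} → i ≢ j → δᶜ i j ≡ 1
δᶜ-≢ {i = i} {j} i≢j with i ≟ j
... | yes i≡j = contradiction i≡j i≢j
... | no _    = refl

δ-sym : ∀ {n} (i j : Fin n) → δ i j ≡ δ j i
δ-sym i j with i ≟ j | j ≟ i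
... | yes _    | yes _    = refl
... | no _     | no _     = refl
... | yes refl | no j≢i   = contradiction refl j≢i
... | no i≢j   | yes refl = contradiction refl i≢j

δ+δᶜ : ∀ {n} (i j : Fin n) → δ i j + δᶜ i j ≡ 1
δ+δᶜ i j with does (i ≟ j)
... | true  = refl
... | false = refl

sum-const : ∀ n c → sum {n} (λ _ → c) ≡ n * c
sum-const zero    c = refl
sum-const (suc n) c = cong (c +_) (sum-const n c)

sum≡0⇒≡0 : ∀ {n} (f : Fin n → ℕ) → sum f ≡ 0 → ∀ i → f i ≡ 0
sum≡0⇒≡0 f eq zero    = m+n≡0⇒m≡0 (f zero) eq
sum≡0⇒≡0 f eq (suc i) = sum≡0⇒≡0 (f ∘ suc) (m+n≡0⇒n≡0 (f zero) eq) i

sum-δ : ∀ {n} (j : Fin n) (f : Fin n → ℕ) → sum (λ i → δ i j * f i) ≡ f j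
sum-δ {suc n} zero    f = begin
  f zero + 0 + sum (λ i → 0 * f (suc i)) ≡⟨ cong (f zero + 0 +_) (sum-const n 0) ⟩
  f zero + 0 + n * 0                       ≡⟨ cong (f zero + 0 +_) (*-zeroʳ n) ⟩
  f zero + 0 + 0                           ≡⟨ trans (+-identityʳ _) (+-identityʳ _) ⟩
  f zero                                   ∎
sum-δ {suc n} (suc j) f = begin
  0 + sum (λ i → δ i j * f (suc i)) ≡⟨ sum-δ j (f ∘ suc) ⟩
  f (suc j) ∎

sum-split : ∀ {n} (j : Fin n) (f : Fin n → ℕ) → sum f ≡ f j + sum (λ i → δᶜ i j * f i)
sum-split j f = begin
  sum f                                               ≡⟨ sum-cong-≗ split ⟩
  sum (λ i → δ i j * f i + δᶜ i j * f i)              ≡⟨ ∑-distrib-+ (λ i → δ i j * f i) _ ⟩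
  sum (λ i → δ i j * f i) + sum (λ i → δᶜ i j * f i) ≡⟨ cong (_+ sum (λ i → δᶜ i j * f i)) (sum-δ j f) ⟩
  f j + sum (λ i → δᶜ i j * f i)                      ∎
  where
  split : ∀ i → f i ≡ δ i j * f i + δᶜ i j * f i
  split i = sym (trans (sym (*-distribʳ-+ (f i) (δ i j) (δᶜ i j)))
                       (trans (cong (_* f i) (δ+δᶜ i j)) (*-identityˡ (f i))))

suc-sum-δᶜ : ∀ {n} (j : Fin n) → suc (sum (λ i → δᶜ i j)) ≡ n
suc-sum-δᶜ {n} j = begin
  suc (sum (λ i → δᶜ i j))      ≡⟨ cong suc (sum-cong-≗ (λ i → sym (*-identityʳ (δᶜ i j)))) ⟩
  suc (sum (λ i → δᶜ i j * 1))  ≡⟨ sum-split j (λ _ → 1) ⟨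
  sum {n} (λ _ → 1)             ≡⟨ sum-const n 1 ⟩
  n * 1                         ≡⟨ *-identityʳ n ⟩
  n                             ∎

sum-involution : ∀ {n} (π : Fin n → Fin n) → (∀ i → π (π i) ≡ i) →
                 (f : Fin n → ℕ) → sum (f ∘ π) ≡ sum f
sum-involution π π-invol f = sym (sum-permute f (permutation π π π-invol π-invol))

sum-↑ : ∀ {m n} (f : Fin (m + n) → ℕ) → sum f ≡ sum {m} (λ i → f (i ↑ˡ n)) + sum {n} (λ j → f (m ↑ʳ j))
sum-↑ {zero}      f = refl
sum-↑ {suc m} {n} f = trans (cong (f zero +_) (sum-↑ {m} (f ∘ suc))) (sym (+-assoc (f zero) _ _))

sum-combine : ∀ {m n} (f : Fin (m * n) → ℕ) → sum f ≡ sum {m} (λ i → sum {n} (λ j → f (combine i j)))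
sum-combine {zero}      f = refl
sum-combine {suc m} {n} f =
  trans (sum-↑ {n} f) (cong (sum {n} (λ j → f (j ↑ˡ (m * n))) +_) (sum-combine {m} (f ∘ (n ↑ʳ_))))

sum-*ˡ : ∀ {n} c (f : Fin n → ℕ) → sum (λ i → c * f i) ≡ c * sum f
sum-*ˡ c f = sym (*-distribˡ-sum c f)

sum-*ʳ : ∀ {n} c (f : Fin n → ℕ) → sum (λ i → f i * c) ≡ sum f * c
sum-*ʳ c f = sym (*-distribʳ-sum c f)

sum-* : ∀ {m n} (f : Fin m → ℕ) (g : Fin n → ℕ) → sum f * sum g ≡ sum (λ i → sum (λ j → f i * g j))
sum-* f g = begin
  sum f * sum g                      ≡⟨ sum-*ʳ (sum g) f ⟨
  sum (λ i → f i * sum g)            ≡⟨ sum-cong-≗ (λ i → sum-*ˡ (f i) g) ⟨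
  sum (λ i → sum (λ j → f i * g j))  ∎

sum-δʳ : ∀ {n} (j : Fin n) → sum (λ i → δ j i) ≡ 1
sum-δʳ j = trans (sum-cong-≗ (λ i → trans (δ-sym j i) (sym (*-identityʳ (δ i j))))) (sum-δ j (λ _ → 1))

sum-δδ : ∀ {n} (j k : Fin n) → sum (λ i → δ j i * δ k i) ≡ δ j k
sum-δδ j k = trans (sum-cong-≗ (λ i → cong (_* δ k i) (δ-sym j i))) (trans (sum-δ j (δ k)) (δ-sym k j))

module _ {v n : ℕ} (g : Fin v → Fin n) (a : Fin v → ℕ) where

  sum-fibres : sum {n} (λ m → sum (λ p → a p * δ (g p) m)) ≡ sum a
  sum-fibres = begin
    sum {n} (λ m → sum (λ p → a p * δ (g p) m))  ≡⟨ ∑-comm (λ m p → a p * δ (g p) m) ⟩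
    sum (λ p → sum {n} (λ m → a p * δ (g p) m))  ≡⟨ sum-cong-≗ (λ p → sum-*ˡ (a p) (δ (g p))) ⟩
    sum (λ p → a p * sum (δ (g p)))              ≡⟨ sum-cong-≗ (λ p → cong (a p *_) (sum-δʳ (g p))) ⟩
    sum (λ p → a p * 1)                          ≡⟨ sum-cong-≗ (λ p → *-identityʳ (a p)) ⟩
    sum a                                        ∎

  sum-fibres² : sum {n} (λ m → sum (λ p → a p * δ (g p) m) * sum (λ p → a p * δ (g p) m))
              ≡ sum (λ p → sum (λ q → a p * a q * δ (g p) (g q)))
  sum-fibres² = begin
    sum {n} (λ m → sum (λ p → a p * δ (g p) m) * sum (λ q → a q * δ (g q) m))
      ≡⟨ sum-cong-≗ (λ m → sum-* (λ p → a p * δ (g p) m) (λ q → a q * δ (g q) m)) ⟩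
    sum {n} (λ m → sum (λ p → sum (λ q → (a p * δ (g p) m) * (a q * δ (g q) m))))
      ≡⟨ ∑-comm (λ m p → sum (λ q → (a p * δ (g p) m) * (a q * δ (g q) m))) ⟩
    sum (λ p → sum {n} (λ m → sum (λ q → (a p * δ (g p) m) * (a q * δ (g q) m))))
      ≡⟨ sum-cong-≗ (λ p → ∑-comm (λ m q → (a p * δ (g p) m) * (a q * δ (g q) m))) ⟩
    sum (λ p → sum (λ q → sum {n} (λ m → (a p * δ (g p) m) * (a q * δ (g q) m))))
      ≡⟨ sum-cong-≗ (λ p → sum-cong-≗ (λ q → pair p q)) ⟩
    sum (λ p → sum (λ q → a p * a q * δ (g p) (g q)))  ∎
    where
    pair : ∀ p q → sum {n} (λ m → (a p * δ (g p) m) * (a q * δ (g q) m)) ≡ a p * a q * δ (g p) (g q)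
    pair p q = begin
      sum (λ m → (a p * δ (g p) m) * (a q * δ (g q) m))
        ≡⟨ sum-cong-≗ (λ m → interchange (a p) (δ (g p) m) (a q) (δ (g q) m)) ⟩
      sum (λ m → a p * a q * (δ (g p) m * δ (g q) m))    ≡⟨ sum-*ˡ (a p * a q) (λ m → δ (g p) m * δ (g q) m) ⟩
      a p * a q * sum (λ m → δ (g p) m * δ (g q) m)      ≡⟨ cong (a p * a q *_) (sum-δδ (g p) (g q)) ⟩
      a p * a q * δ (g p) (g q)                          ∎
      where
      interchange : ∀ w x y z → (w * x) * (y * z) ≡ w * y * (x * z)
      interchange = solve-∀

uniform-fibres : ∀ {v n k} (g : Fin v → Fin n) → (∀ m → sum (λ p → δ (g p) m) ≡ k) → n * k ≡ v
uniform-fibres {v} {n} {k} g fibre≡k = begin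
  n * k                                        ≡⟨ sum-const n k ⟨
  sum {n} (λ _ → k)                            ≡⟨ sum-cong-≗ fibre≡k ⟨
  sum (λ m → sum (λ p → δ (g p) m))            ≡⟨ sum-cong-≗ (λ m → sum-cong-≗ (λ p → *-identityˡ (δ (g p) m))) ⟨
  sum (λ m → sum (λ p → 1 * δ (g p) m))        ≡⟨ sum-fibres g (λ _ → 1) ⟩
  sum {v} (λ _ → 1)                            ≡⟨ sum-const v 1 ⟩
  v * 1                                        ≡⟨ *-identityʳ v ⟩
  v                                            ∎

sum-diagonal : ∀ {n} (F : Fin n → Fin n → ℕ) → sum (λ p → sum (λ q → F p q * δ p q)) ≡ sum (λ p → F p p)
sum-diagonal F = sum-cong-≗ (λ p → trans (sum-cong-≗ (λ q → trans (*-comm (F p q) (δ p q)) (cong (_* F p q) (δ-sym p q))))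
                                        (sum-δ p (F p)))

sum₂-+ : ∀ {m n} (f g : Fin m → Fin n → ℕ) →
         sum (λ p → sum (λ q → f p q + g p q)) ≡ sum (λ p → sum (f p)) + sum (λ p → sum (g p))
sum₂-+ f g = trans (sum-cong-≗ (λ p → ∑-distrib-+ (f p) (g p))) (∑-distrib-+ (λ p → sum (f p)) (λ p → sum (g p)))

-- The hypothesis says that C = λ J + (r - λ) I, the concurrence matrix of a design with
-- replication number r and index λ.
concurrence-form : ∀ {v} (C : Fin v → Fin v → ℕ) (λ₀ r : ℕ) →
  (∀ p q → C p q + λ₀ * δ p q ≡ λ₀ + r * δ p q) → (a : Fin v → ℕ) →
  sum (λ p → sum (λ q → a p * a q * C p q)) + λ₀ * sum (λ p → a p * a p)
    ≡ λ₀ * (sum a * sum a) + r * sum (λ p → a p * a p)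
concurrence-form C λ₀ r C-spec a = begin
  sum (λ p → sum (λ q → F p q * C p q)) + λ₀ * sum (λ p → a p * a p)
    ≡⟨ cong (sum (λ p → sum (λ q → F p q * C p q)) +_) (diagonal λ₀) ⟨
  sum (λ p → sum (λ q → F p q * C p q)) + sum (λ p → sum (λ q → F p q * (λ₀ * δ p q)))
    ≡⟨ sum₂-+ (λ p q → F p q * C p q) (λ p q → F p q * (λ₀ * δ p q)) ⟨
  sum (λ p → sum (λ q → F p q * C p q + F p q * (λ₀ * δ p q)))
    ≡⟨ sum-cong-≗ (λ p → sum-cong-≗ (λ q → pointwise p q)) ⟩
  sum (λ p → sum (λ q → λ₀ * F p q + F p q * (r * δ p q)))
    ≡⟨ sum₂-+ (λ p q → λ₀ * F p q) (λ p q → F p q * (r * δ p q)) ⟩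
  sum (λ p → sum (λ q → λ₀ * F p q)) + sum (λ p → sum (λ q → F p q * (r * δ p q)))
    ≡⟨ cong₂ _+_ full (diagonal r) ⟩
  λ₀ * (sum a * sum a) + r * sum (λ p → a p * a p)  ∎
  where
  F : Fin _ → Fin _ → ℕ
  F p q = a p * a q
  pointwise : ∀ p q → F p q * C p q + F p q * (λ₀ * δ p q) ≡ λ₀ * F p q + F p q * (r * δ p q)
  pointwise p q = begin
    F p q * C p q + F p q * (λ₀ * δ p q)  ≡⟨ *-distribˡ-+ (F p q) (C p q) _ ⟨
    F p q * (C p q + λ₀ * δ p q)          ≡⟨ cong (F p q *_) (C-spec p q) ⟩
    F p q * (λ₀ + r * δ p q)              ≡⟨ *-distribˡ-+ (F p q) λ₀ _ ⟩
    F p q * λ₀ + F p q * (r * δ p q)      ≡⟨ cong (_+ F p q * (r * δ p q)) (*-comm (F p q) λ₀) ⟩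
    λ₀ * F p q + F p q * (r * δ p q)      ∎
  diagonal : ∀ c → sum (λ p → sum (λ q → F p q * (c * δ p q))) ≡ c * sum (λ p → a p * a p)
  diagonal c = begin
    sum (λ p → sum (λ q → F p q * (c * δ p q)))  ≡⟨ sum-cong-≗ (λ p → sum-cong-≗ (λ q → pull c (F p q) (δ p q))) ⟩
    sum (λ p → sum (λ q → c * (F p q * δ p q)))  ≡⟨ sum-cong-≗ (λ p → sum-*ˡ c (λ q → F p q * δ p q)) ⟩
    sum (λ p → c * sum (λ q → F p q * δ p q))    ≡⟨ sum-*ˡ c (λ p → sum (λ q → F p q * δ p q)) ⟩
    c * sum (λ p → sum (λ q → F p q * δ p q))    ≡⟨ cong (c *_) (sum-diagonal F) ⟩
    c * sum (λ p → a p * a p)                    ∎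
    where
    pull : ∀ c x y → x * (c * y) ≡ c * (x * y)
    pull = solve-∀
  full : sum (λ p → sum (λ q → λ₀ * F p q)) ≡ λ₀ * (sum a * sum a)
  full = begin
    sum (λ p → sum (λ q → λ₀ * F p q))  ≡⟨ sum-cong-≗ (λ p → sum-*ˡ λ₀ (F p)) ⟩
    sum (λ p → λ₀ * sum (F p))          ≡⟨ sum-*ˡ λ₀ (λ p → sum (F p)) ⟩
    λ₀ * sum (λ p → sum (F p))          ≡⟨ cong (λ₀ *_) (sum-* a a) ⟨
    λ₀ * (sum a * sum a)                ∎

∣-∣²+2mn : ∀ m n → ∣ m - n ∣ * ∣ m - n ∣ + 2 * m * n ≡ m * m + n * n
∣-∣²+2mn zero    n       = +-identityʳ (n * n)
∣-∣²+2mn (suc m) zero    = lemma (suc m)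
  where
  lemma : ∀ m → m * m + 2 * m * 0 ≡ m * m + 0 * 0
  lemma = solve-∀
∣-∣²+2mn (suc m) (suc n) = begin
  ∣ m - n ∣ * ∣ m - n ∣ + 2 * suc m * suc n          ≡⟨ expand ∣ m - n ∣ m n ⟩
  (∣ m - n ∣ * ∣ m - n ∣ + 2 * m * n) + 2 * (1 + m + n) ≡⟨ cong (_+ 2 * (1 + m + n)) (∣-∣²+2mn m n) ⟩
  (m * m + n * n) + 2 * (1 + m + n)                  ≡⟨ collect m n ⟩
  suc m * suc m + suc n * suc n                      ∎
  where
  expand : ∀ d m n → d * d + 2 * (1 + m) * (1 + n) ≡ (d * d + 2 * m * n) + 2 * (1 + m + n)
  expand = solve-∀
  collect : ∀ m n → (m * m + n * n) + 2 * (1 + m + n) ≡ (1 + m) * (1 + m) + (1 + n) * (1 + n)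
  collect = solve-∀

-- Σ (n xₘ - s)² = n² Σ xₘ² - n s² when Σ xₘ = s, with the subtracted term moved across.
sum-∣-∣² : ∀ {n} (x : Fin n → ℕ) s → sum x ≡ s →
  sum (λ m → ∣ n * x m - s ∣ * ∣ n * x m - s ∣) + n * (s * s) ≡ n * n * sum (λ m → x m * x m)
sum-∣-∣² {n} x s Σx≡s = +-cancelʳ-≡ (n * (s * s)) _ _ (begin
  D + n * (s * s) + n * (s * s)                       ≡⟨ double D n s ⟩
  D + 2 * n * s * s                                   ≡⟨ cong (λ t → D + 2 * n * s * t) Σx≡s ⟨
  D + 2 * n * s * sum x                               ≡⟨ cong (D +_) (sum-*ˡ (2 * n * s) x) ⟨
  D + sum (λ m → 2 * n * s * x m)                     ≡⟨ cong (D +_) (sum-cong-≗ (λ m → rearrange n s (x m))) ⟩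
  D + sum (λ m → 2 * (n * x m) * s)                   ≡⟨ ∑-distrib-+ (λ m → ∣ n * x m - s ∣ * ∣ n * x m - s ∣) _ ⟨
  sum (λ m → ∣ n * x m - s ∣ * ∣ n * x m - s ∣ + 2 * (n * x m) * s)
                                                      ≡⟨ sum-cong-≗ (λ m → ∣-∣²+2mn (n * x m) s) ⟩
  sum (λ m → n * x m * (n * x m) + s * s)             ≡⟨ ∑-distrib-+ (λ m → n * x m * (n * x m)) (λ _ → s * s) ⟩
  sum (λ m → n * x m * (n * x m)) + sum {n} (λ _ → s * s)
                                                      ≡⟨ cong₂ _+_ (sum-cong-≗ (λ m → square n (x m))) (sum-const n (s * s)) ⟩
  sum (λ m → n * n * (x m * x m)) + n * (s * s)       ≡⟨ cong (_+ n * (s * s)) (sum-*ˡ (n * n) (λ m → x m * x m)) ⟩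
  n * n * sum (λ m → x m * x m) + n * (s * s)         ∎)
  where
  D = sum (λ m → ∣ n * x m - s ∣ * ∣ n * x m - s ∣)
  double : ∀ d n s → d + n * (s * s) + n * (s * s) ≡ d + 2 * n * s * s
  double = solve-∀
  rearrange : ∀ n s x → 2 * n * s * x ≡ 2 * (n * x) * s
  rearrange = solve-∀
  square : ∀ n x → n * x * (n * x) ≡ n * n * (x * x)
  square = solve-∀

-- Resolved designs and Bose's intersection theorem

-- block t p is the block of the t-th parallel class that contains the point p.
record Resolution (v k lam r n : ℕ) : Set where
  field
    block       : Fin r → Fin v → Fin n
    block-size  : ∀ t m → sum (λ p → δ (block t p) m) ≡ k
    concurrence : ∀ p q → p ≢ q → sum (λ t → δ (block t p) (block t q)) ≡ lam

module Resolution-properties {v k lam r n : ℕ} (R : Resolution v k lam r n) where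
  open Resolution R

  class-size : Fin r → n * k ≡ v
  class-size t = uniform-fibres (block t) (block-size t)

  concurrence-δ : ∀ p q → sum (λ t → δ (block t p) (block t q)) + lam * δ p q ≡ lam + r * δ p q
  concurrence-δ p q with p ≟ q
  ... | yes refl = begin
    sum (λ t → δ (block t p) (block t p)) + lam * 1 ≡⟨ cong₂ _+_ (sum-cong-≗ (λ t → δ-refl (block t p))) (*-identityʳ lam) ⟩
    sum {r} (λ _ → 1) + lam                        ≡⟨ cong (_+ lam) (sum-const r 1) ⟩
    r * 1 + lam                                    ≡⟨ +-comm (r * 1) lam ⟩
    lam + r * 1                                    ∎
  ... | no p≢q = begin
    sum (λ t → δ (block t p) (block t q)) + lam * 0 ≡⟨ cong₂ _+_ (concurrence p q p≢q) (*-zeroʳ lam) ⟩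
    lam + 0                                        ≡⟨ cong (lam +_) (*-zeroʳ r) ⟨
    lam + r * 0                                    ∎

  replication : Fin v → r * k + lam ≡ r + v * lam
  replication p = begin
    r * k + lam                                              ≡⟨ cong (_+ lam) (sum-const r k) ⟨
    sum {r} (λ _ → k) + lam                                  ≡⟨ cong (_+ lam) (sum-cong-≗ (λ t → block-size t (block t p))) ⟨
    sum (λ t → sum (λ q → δ (block t q) (block t p))) + lam
      ≡⟨ cong (_+ lam) (∑-comm (λ t q → δ (block t q) (block t p))) ⟩
    sum C + lam                              ≡⟨ cong (_+ lam) (sum-split p C) ⟩
    C p + sum (λ q → δᶜ q p * C q) + lam     ≡⟨ cong (λ c → c + sum (λ q → δᶜ q p * C q) + lam) C-diagonal ⟩
    r + sum (λ q → δᶜ q p * C q) + lam       ≡⟨ cong (λ c → r + c + lam) (sum-cong-≗ off-diagonal) ⟩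
    r + sum (λ q → δᶜ q p * lam) + lam       ≡⟨ +-assoc r _ lam ⟩
    r + (sum (λ q → δᶜ q p * lam) + lam)     ≡⟨ cong (λ c → r + (c + lam)) (sum-*ʳ lam (λ q → δᶜ q p)) ⟩
    r + (sum (λ q → δᶜ q p) * lam + lam)     ≡⟨ cong (r +_) (+-comm _ lam) ⟩
    r + suc (sum (λ q → δᶜ q p)) * lam       ≡⟨ cong (λ c → r + c * lam) (suc-sum-δᶜ p) ⟩
    r + v * lam                              ∎
    where
    C : Fin v → ℕ
    C q = sum (λ t → δ (block t q) (block t p))
    C-diagonal : C p ≡ r
    C-diagonal = trans (sum-cong-≗ (λ t → δ-refl (block t p))) (trans (sum-const r 1) (*-identityʳ r))
    off-diagonal : ∀ q → δᶜ q p * C q ≡ δᶜ q p * lam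
    off-diagonal q with q ≟ p
    ... | yes _   = refl
    ... | no q≢p = cong (_+ 0) (concurrence q p q≢p)

-- Bose's argument: for each block B of class t, the sizes xₘ = ∣B ∩ Bₘ∣ over the blocks Bₘ of
-- another class have mean k/n, and counting flags shows that their variances sum to zero.
module Affine {v k lam r n : ℕ} (R : Resolution v k lam r n)
              (r≡1+nλ : r ≡ suc (n * lam)) (k+λ≡r : k + lam ≡ r) where
  open Resolution R
  open Resolution-properties R

  meet : Fin r → Fin n → Fin r → Fin n → ℕ
  meet t m t' m' = sum (λ p → δ (block t p) m * δ (block t' p) m')

  module _ (t : Fin r) (m : Fin n) where

    private
      X : Fin v → ℕ
      X p = δ (block t p) m

      x : Fin r → Fin n → ℕ
      x = meet t m

      Q : Fin r → ℕ
      Q t' = sum (λ m' → x t' m' * x t' m')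

      Z : Fin r → ℕ
      Z t' = sum (λ m' → ∣ n * x t' m' - k ∣ * ∣ n * x t' m' - k ∣)

    sum-meet : ∀ t' → sum (x t') ≡ k
    sum-meet t' = trans (sum-fibres (block t') X) (block-size t m)

    sum-sum-meet² : sum Q + lam * k ≡ lam * (k * k) + r * k
    sum-sum-meet² = begin
      sum Q + lam * k
        ≡⟨ cong₂ (λ a b → a + lam * b) (sum-cong-≗ (λ t' → sum-fibres² (block t') X)) (sym sum-X²) ⟩
      sum (λ t' → sum (λ p → sum (λ q → X p * X q * δ (block t' p) (block t' q)))) + lam * sum (λ p → X p * X p)
        ≡⟨ cong (λ a → a + lam * sum (λ p → X p * X p)) swap ⟩
      sum (λ p → sum (λ q → X p * X q * sum (λ t' → δ (block t' p) (block t' q)))) + lam * sum (λ p → X p * X p)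
        ≡⟨ concurrence-form (λ p q → sum (λ t' → δ (block t' p) (block t' q))) lam r concurrence-δ X ⟩
      lam * (sum X * sum X) + r * sum (λ p → X p * X p)
        ≡⟨ cong₂ (λ a b → lam * (a * a) + r * b) (block-size t m) sum-X² ⟩
      lam * (k * k) + r * k ∎
      where
      sum-X² : sum (λ p → X p * X p) ≡ k
      sum-X² = trans (sum-cong-≗ (λ p → ⟦⟧-idem (does (block t p ≟ m)))) (block-size t m)
      swap : sum (λ t' → sum (λ p → sum (λ q → X p * X q * δ (block t' p) (block t' q))))
           ≡ sum (λ p → sum (λ q → X p * X q * sum (λ t' → δ (block t' p) (block t' q))))
      swap = begin
        sum (λ t' → sum (λ p → sum (λ q → X p * X q * δ (block t' p) (block t' q))))
          ≡⟨ ∑-comm (λ t' p → sum (λ q → X p * X q * δ (block t' p) (block t' q))) ⟩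
        sum (λ p → sum (λ t' → sum (λ q → X p * X q * δ (block t' p) (block t' q))))
          ≡⟨ sum-cong-≗ (λ p → ∑-comm (λ t' q → X p * X q * δ (block t' p) (block t' q))) ⟩
        sum (λ p → sum (λ q → sum (λ t' → X p * X q * δ (block t' p) (block t' q))))
          ≡⟨ sum-cong-≗ (λ p → sum-cong-≗ (λ q → sum-*ˡ (X p * X q) (λ t' → δ (block t' p) (block t' q)))) ⟩
        sum (λ p → sum (λ q → X p * X q * sum (λ t' → δ (block t' p) (block t' q)))) ∎

    meet-self : ∀ m' → x t m' ≡ δ m m' * k
    meet-self m' = begin
      sum (λ p → X p * δ (block t p) m') ≡⟨ sum-cong-≗ (λ p → pointwise (block t p)) ⟩
      sum (λ p → δ m m' * X p)           ≡⟨ sum-*ˡ (δ m m') X ⟩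
      δ m m' * sum X                     ≡⟨ cong (δ m m' *_) (block-size t m) ⟩
      δ m m' * k                         ∎
      where
      pointwise : ∀ b → δ b m * δ b m' ≡ δ m m' * δ b m
      pointwise b with b ≟ m
      ... | yes refl = *-comm 1 (δ b m')
      ... | no _     = sym (*-zeroʳ (δ m m'))

    Q-self : Q t ≡ k * k
    Q-self = begin
      sum (λ m' → x t m' * x t m')             ≡⟨ sum-cong-≗ (λ m' → cong₂ _*_ (meet-self m') (meet-self m')) ⟩
      sum (λ m' → δ m m' * k * (δ m m' * k))   ≡⟨ sum-cong-≗ (λ m' → square (δ m m') k (⟦⟧-idem (does (m ≟ m')))) ⟩
      sum (λ m' → δ m m' * (k * k))            ≡⟨ sum-*ʳ (k * k) (δ m) ⟩
      sum (δ m) * (k * k)                      ≡⟨ cong (_* (k * k)) (sum-δʳ m) ⟩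
      1 * (k * k)                              ≡⟨ *-identityˡ (k * k) ⟩
      k * k                                    ∎
      where
      interchange : ∀ d k → d * k * (d * k) ≡ d * d * (k * k)
      interchange = solve-∀
      square : ∀ d k → d * d ≡ d → d * k * (d * k) ≡ d * (k * k)
      square d k d²≡d = trans (interchange d k) (cong (_* (k * k)) d²≡d)

    classes-other-than-t : sum (λ t' → δᶜ t' t) ≡ n * lam
    classes-other-than-t = suc-injective (trans (suc-sum-δᶜ t) r≡1+nλ)

    Q-others : sum (λ t' → δᶜ t' t * Q t') ≡ lam * (k * k)
    Q-others = +-cancelʳ-≡ (k * k + lam * k) _ _ (begin
      Σ' + (k * k + lam * k)     ≡⟨ shuffle Σ' (k * k) (lam * k) ⟩
      (k * k + Σ') + lam * k     ≡⟨ cong (λ a → a + Σ' + lam * k) Q-self ⟨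
      (Q t + Σ') + lam * k       ≡⟨ cong (_+ lam * k) (sum-split t Q) ⟨
      sum Q + lam * k            ≡⟨ sum-sum-meet² ⟩
      lam * (k * k) + r * k      ≡⟨ cong (λ a → lam * (k * k) + a * k) k+λ≡r ⟨
      lam * (k * k) + (k + lam) * k ≡⟨ expand lam k ⟩
      lam * (k * k) + (k * k + lam * k) ∎)
      where
      Σ' = sum (λ t' → δᶜ t' t * Q t')
      shuffle : ∀ s a b → s + (a + b) ≡ (a + s) + b
      shuffle = solve-∀
      expand : ∀ l k → l * (k * k) + (k + l) * k ≡ l * (k * k) + (k * k + l * k)
      expand = solve-∀

    Z-others : sum (λ t' → δᶜ t' t * Z t') ≡ 0
    Z-others = +-cancelʳ-≡ (n * (k * k) * (n * lam)) _ _ (begin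
      Σ' + n * (k * k) * (n * lam)
        ≡⟨ cong (λ c → Σ' + n * (k * k) * c) classes-other-than-t ⟨
      Σ' + n * (k * k) * sum (λ t' → δᶜ t' t)
        ≡⟨ cong (Σ' +_) (sum-*ˡ (n * (k * k)) (λ t' → δᶜ t' t)) ⟨
      Σ' + sum (λ t' → n * (k * k) * δᶜ t' t)
        ≡⟨ ∑-distrib-+ (λ t' → δᶜ t' t * Z t') _ ⟨
      sum (λ t' → δᶜ t' t * Z t' + n * (k * k) * δᶜ t' t)
        ≡⟨ sum-cong-≗ (λ t' → factor (δᶜ t' t) (Z t') (n * (k * k))) ⟩
      sum (λ t' → δᶜ t' t * (Z t' + n * (k * k)))
        ≡⟨ sum-cong-≗ (λ t' → cong (δᶜ t' t *_) (sum-∣-∣² (x t') k (sum-meet t'))) ⟩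
      sum (λ t' → δᶜ t' t * (n * n * Q t'))
        ≡⟨ sum-cong-≗ (λ t' → pull (δᶜ t' t) (n * n) (Q t')) ⟩
      sum (λ t' → n * n * (δᶜ t' t * Q t'))
        ≡⟨ sum-*ˡ (n * n) (λ t' → δᶜ t' t * Q t') ⟩
      n * n * Σ-Q
        ≡⟨ cong (n * n *_) Q-others ⟩
      n * n * (lam * (k * k))
        ≡⟨ regroup n lam k ⟩
      0 + n * (k * k) * (n * lam) ∎)
      where
      Σ' = sum (λ t' → δᶜ t' t * Z t')
      Σ-Q = sum (λ t' → δᶜ t' t * Q t')
      factor : ∀ d z c → d * z + c * d ≡ d * (z + c)
      factor = solve-∀
      pull : ∀ d c q → d * (c * q) ≡ c * (d * q)
      pull = solve-∀
      regroup : ∀ n l k → n * n * (l * (k * k)) ≡ 0 + n * (k * k) * (n * l)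
      regroup = solve-∀

  affine-intersection : ∀ t m t' m' → t' ≢ t → n * meet t m t' m' ≡ k
  affine-intersection t m t' m' t'≢t = ∣m-n∣≡0⇒m≡n (square≡0 (sum≡0⇒≡0 (Z t') Z≡0 m'))
    where
    Z : Fin r → Fin n → ℕ
    Z t'' m'' = ∣ n * meet t m t'' m'' - k ∣ * ∣ n * meet t m t'' m'' - k ∣
    square≡0 : ∀ {d} → d * d ≡ 0 → d ≡ 0
    square≡0 {d} d²≡0 = [ id , id ]′ (m*n≡0⇒m≡0∨n≡0 d d²≡0)
    Z≡0 : sum (Z t') ≡ 0
    Z≡0 = trans (sym (trans (cong (_* sum (Z t')) (δᶜ-≢ t'≢t)) (+-identityʳ _)))
                (sum≡0⇒≡0 (λ t'' → δᶜ t'' t * sum (Z t'')) (Z-others t m) t')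

-- Subtraction modulo ℓ

-- a ≡ i (mod ℓ), for sums a of two residues.
Wrap : ℕ → ℕ → ℕ → Set
Wrap ℓ a i = a ≡ i ⊎ a ≡ ℓ + i

wrap-unique : ∀ {ℓ a i i'} → i < ℓ → i' < ℓ → Wrap ℓ a i → Wrap ℓ a i' → i ≡ i'
wrap-unique _    _     (inj₁ a≡i)  (inj₁ a≡i')  = trans (sym a≡i) a≡i'
wrap-unique {ℓ} _ _    (inj₂ a≡ℓi) (inj₂ a≡ℓi') = +-cancelˡ-≡ ℓ _ _ (trans (sym a≡ℓi) a≡ℓi')
wrap-unique {ℓ} {i' = i'} i<ℓ _ (inj₁ a≡i) (inj₂ a≡ℓi') =
  contradiction (subst (ℓ ≤_) (trans (sym a≡ℓi') a≡i) (m≤m+n ℓ i')) (<⇒≱ i<ℓ)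
wrap-unique {ℓ} {i = i} _ i'<ℓ (inj₂ a≡ℓi) (inj₁ a≡i') =
  contradiction (subst (ℓ ≤_) (trans (sym a≡ℓi) a≡i') (m≤m+n ℓ i)) (<⇒≱ i'<ℓ)

wrap-overshoot : ∀ {ℓ j s s' i} → s' < ℓ → j + s ≡ i → j + s' ≡ ℓ + i → ⊥
wrap-overshoot {ℓ} {j} {s} {s'} {i} s'<ℓ js≡i js'≡ℓi = <⇒≱ s'<ℓ (subst (ℓ ≤_) (sym s'≡ℓ+s) (m≤m+n ℓ s))
  where
  exchange : ∀ a b c → a + (b + c) ≡ b + (a + c)
  exchange = solve-∀
  s'≡ℓ+s : s' ≡ ℓ + s
  s'≡ℓ+s = +-cancelˡ-≡ j s' (ℓ + s) (trans js'≡ℓi (trans (cong (ℓ +_) (sym js≡i)) (exchange ℓ j s)))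

wrap-cancel : ∀ {ℓ j s s' i} → s < ℓ → s' < ℓ → Wrap ℓ (j + s) i → Wrap ℓ (j + s') i → s ≡ s'
wrap-cancel {j = j} _   _    (inj₁ e) (inj₁ e') = +-cancelˡ-≡ j _ _ (trans e (sym e'))
wrap-cancel {j = j} _   _    (inj₂ e) (inj₂ e') = +-cancelˡ-≡ j _ _ (trans e (sym e'))
wrap-cancel         _   s'<ℓ (inj₁ e) (inj₂ e') = ⊥-elim (wrap-overshoot s'<ℓ e e')
wrap-cancel         s<ℓ _    (inj₂ e) (inj₁ e') = ⊥-elim (wrap-overshoot s<ℓ e' e)

diff : ℕ → ℕ → ℕ → ℕ
diff ℓ i j with j ≤? i
... | yes _ = i ∸ j
... | no _  = ℓ + i ∸ j

diff-wrap : ∀ {ℓ} i j → i < ℓ → j < ℓ → diff ℓ i j < ℓ × Wrap ℓ (j + diff ℓ i j) i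
diff-wrap {ℓ} i j i<ℓ j<ℓ with j ≤? i
... | yes j≤i = ≤-<-trans (m∸n≤m i j) i<ℓ , inj₁ (m+[n∸m]≡n j≤i)
... | no j≰i  = +-cancelˡ-< j _ _ bound , inj₂ wrap
  where
  wrap : j + (ℓ + i ∸ j) ≡ ℓ + i
  wrap = m+[n∸m]≡n (≤-trans (<⇒≤ j<ℓ) (m≤m+n ℓ i))
  bound : j + (ℓ + i ∸ j) < j + ℓ
  bound = subst (_< j + ℓ) (sym wrap) (subst (ℓ + i <_) (+-comm ℓ j) (+-monoʳ-< ℓ (≰⇒> j≰i)))

_⊖_ : ∀ {ℓ} → Fin ℓ → Fin ℓ → Fin ℓ
i ⊖ j = Fin.fromℕ< (proj₁ (diff-wrap (Fin.toℕ i) (Fin.toℕ j) (toℕ<n i) (toℕ<n j)))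

⊖-wrap : ∀ {ℓ} (i j : Fin ℓ) → Wrap ℓ (Fin.toℕ j + Fin.toℕ (i ⊖ j)) (Fin.toℕ i)
⊖-wrap {ℓ} i j = subst (λ s → Wrap ℓ (Fin.toℕ j + s) (Fin.toℕ i)) (sym (toℕ-fromℕ< _))
                       (proj₂ (diff-wrap (Fin.toℕ i) (Fin.toℕ j) (toℕ<n i) (toℕ<n j)))

⊖-injectiveˡ : ∀ {ℓ} {i i' j : Fin ℓ} → i ⊖ j ≡ i' ⊖ j → i ≡ i'
⊖-injectiveˡ {ℓ} {i} {i'} {j} eq = toℕ-injective (wrap-unique (toℕ<n i) (toℕ<n i') (⊖-wrap i j)
  (subst (λ s → Wrap ℓ (Fin.toℕ j + Fin.toℕ s) (Fin.toℕ i')) (sym eq) (⊖-wrap i' j)))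

⊖-involutive : ∀ {ℓ} (i j : Fin ℓ) → i ⊖ (i ⊖ j) ≡ j
⊖-involutive {ℓ} i j = toℕ-injective (wrap-cancel (toℕ<n (i ⊖ (i ⊖ j))) (toℕ<n j) (⊖-wrap i (i ⊖ j))
  (subst (λ a → Wrap ℓ a (Fin.toℕ i)) (+-comm (Fin.toℕ j) _) (⊖-wrap i j)))

⊖-self : ∀ {ℓ} (i : Fin (suc ℓ)) → i ⊖ i ≡ zero
⊖-self i = toℕ-injective (wrap-cancel (toℕ<n (i ⊖ i)) (toℕ<n {suc _} zero) (⊖-wrap i i) (inj₁ (+-identityʳ (Fin.toℕ i))))

⊖≡zero⇒≡ : ∀ {ℓ} {i j : Fin (suc ℓ)} → i ⊖ j ≡ zero → i ≡ j
⊖≡zero⇒≡ {ℓ} {i} {j} eq = toℕ-injective (wrap-unique (toℕ<n i) (toℕ<n j)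
  (subst (λ s → Wrap (suc ℓ) (Fin.toℕ j + Fin.toℕ s) (Fin.toℕ i)) eq (⊖-wrap i j)) (inj₁ (+-identityʳ (Fin.toℕ j))))

countᵇ : ∀ {A : Set} → (A → Bool) → List A → ℕ
countᵇ P xs = length (filterᵇ P xs)

countᵇ-∷ : ∀ {A : Set} (P : A → Bool) x xs → countᵇ P (x ∷ xs) ≡ ⟦ P x ⟧ + countᵇ P xs
countᵇ-∷ P x xs with P x
... | true  = refl
... | false = refl

countᵇ-++ : ∀ {A : Set} (P : A → Bool) xs ys → countᵇ P (xs ++ ys) ≡ countᵇ P xs + countᵇ P ys
countᵇ-++ P xs ys = trans (cong length (filter-++ (T? ∘ P) xs ys)) (length-++ (filterᵇ P xs))

countᵇ-tabulate : ∀ {A : Set} (P : A → Bool) {n} (g : Fin n → A) → countᵇ P (List.tabulate g) ≡ sum (λ i → ⟦ P (g i) ⟧)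
countᵇ-tabulate P {zero}  g = refl
countᵇ-tabulate P {suc n} g = trans (countᵇ-∷ P (g zero) _) (cong (⟦ P (g zero) ⟧ +_) (countᵇ-tabulate P (g ∘ suc)))

countᵇ-concat-tabulate : ∀ {A : Set} (P : A → Bool) {n} (G : Fin n → List A) →
                         countᵇ P (concat (List.tabulate G)) ≡ sum (λ j → countᵇ P (G j))
countᵇ-concat-tabulate P {zero}  G = refl
countᵇ-concat-tabulate P {suc n} G =
  trans (countᵇ-++ P (G zero) _) (cong (countᵇ P (G zero) +_) (countᵇ-concat-tabulate P (G ∘ suc)))

countᵇ-lookup : ∀ {A : Set} (P : A → Bool) xs → countᵇ P xs ≡ sum (λ i → ⟦ P (List.lookup xs i) ⟧)
countᵇ-lookup P xs = trans (cong (countᵇ P) (sym (tabulate-lookup xs))) (countᵇ-tabulate P (List.lookup xs))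

countᵇ-concat : ∀ {A : Set} (P : A → Bool) xss → countᵇ P (concat xss) ≡ sum (λ j → countᵇ P (List.lookup xss j))
countᵇ-concat P xss =
  trans (cong (countᵇ P ∘ concat) (sym (tabulate-lookup xss))) (countᵇ-concat-tabulate P (List.lookup xss))

countᵇ-↭ : ∀ {A : Set} (P : A → Bool) {xs ys} → xs ↭ ys → countᵇ P xs ≡ countᵇ P ys
countᵇ-↭ P xs↭ys = ↭-length (filter-↭ (T? ∘ P) xs↭ys)

length-concat-tabulate : ∀ {A : Set} {n} (G : Fin n → List A) → length (concat (List.tabulate G)) ≡ sum (λ j → length (G j))
length-concat-tabulate {n = zero}  G = refl
length-concat-tabulate {n = suc n} G = trans (length-++ (G zero)) (cong (length (G zero) +_) (length-concat-tabulate (G ∘ suc)))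

∣∣≡sum : ∀ {n} (B : Subset n) → ∣ B ∣ ≡ sum (λ x → ⟦ Vec.lookup B x ⟧)
∣∣≡sum []           = refl
∣∣≡sum (true ∷ B)  = cong suc (∣∣≡sum B)
∣∣≡sum (false ∷ B) = ∣∣≡sum B

sum⟦⟧≡1⇒δ : ∀ {n} (h : Fin n → Bool) → sum (λ m → ⟦ h m ⟧) ≡ 1 →
            Σ (Fin n) λ m₀ → ∀ m → ⟦ h m ⟧ ≡ δ m₀ m
sum⟦⟧≡1⇒δ {suc n} h sum≡1 with h zero in h₀
... | true  = zero , λ { zero → cong ⟦_⟧ h₀ ; (suc m) → sum≡0⇒≡0 (λ m → ⟦ h (suc m) ⟧) (suc-injective sum≡1) m }
... | false with sum⟦⟧≡1⇒δ (h ∘ suc) sum≡1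
...   | m₀ , h≡δ = suc m₀ , λ { zero → cong ⟦_⟧ h₀ ; (suc m) → h≡δ m }

δ-subst : ∀ {a b} (e : a ≡ b) (x : Fin a) (y : Fin b) → δ (subst Fin e x) y ≡ δ x (subst Fin (sym e) y)
δ-subst refl x y = refl

δ-subst₂ : ∀ {a b} (e : a ≡ b) (x y : Fin a) → δ (subst Fin e x) (subst Fin e y) ≡ δ x y
δ-subst₂ refl x y = refl

module _ {v k lam} .{{_ : NonZero k}} (D : BIBD v k lam) (res : Resolvable D) where

  private
    classes : List (List (Subset v))
    classes = proj₁ res

    class : Fin (length classes) → List (Subset v)
    class = List.lookup classes

    inside : ∀ t → Fin (length (class t)) → Fin v → Bool
    inside t m = Vec.lookup (List.lookup (class t) m)

    block-of : ∀ t x → Σ (Fin (length (class t))) λ m₀ → ∀ m → ⟦ inside t m x ⟧ ≡ δ m₀ m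
    block-of t x = sum⟦⟧≡1⇒δ (λ m → inside t m x)
      (trans (sym (countᵇ-lookup (λ B → Vec.lookup B x) (class t))) (All.lookup (proj₂ (proj₂ res)) (∈-lookup t) x))

    block-index : (t : Fin (length classes)) → Fin v → Fin (length (class t))
    block-index t x = proj₁ (block-of t x)

    ⟦inside⟧≡δ : ∀ t x m → ⟦ inside t m x ⟧ ≡ δ (block-index t x) m
    ⟦inside⟧≡δ t x = proj₂ (block-of t x)

    sizes : All (All (λ B → ∣ B ∣ ≡ k)) classes
    sizes = concat⁻ (All-resp-↭ (↭-sym (proj₁ (proj₂ res))) (blockSize D))

    fibre : ∀ t m → sum (λ p → δ (block-index t p) m) ≡ k
    fibre t m = begin
      sum (λ p → δ (block-index t p) m)   ≡⟨ sum-cong-≗ (λ p → ⟦inside⟧≡δ t p m) ⟨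
      sum (λ p → ⟦ inside t m p ⟧)        ≡⟨ ∣∣≡sum (List.lookup (class t) m) ⟨
      ∣ List.lookup (class t) m ∣         ≡⟨ All.lookup (All.lookup sizes (∈-lookup t)) (∈-lookup m) ⟩
      k                                   ∎

    class-length : ∀ t → length (class t) ≡ v / k
    class-length t = trans (sym (m*n/n≡m _ k)) (cong (_/ k) (uniform-fibres (block-index t) (fibre t)))

    pairs-in-class : ∀ t p q → countᵇ (λ B → Vec.lookup B p ∧ Vec.lookup B q) (class t)
                               ≡ δ (block-index t p) (block-index t q)
    pairs-in-class t p q = begin
      countᵇ (λ B → Vec.lookup B p ∧ Vec.lookup B q) (class t)
        ≡⟨ countᵇ-lookup (λ B → Vec.lookup B p ∧ Vec.lookup B q) (class t) ⟩
      sum (λ m → ⟦ inside t m p ∧ inside t m q ⟧)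
        ≡⟨ sum-cong-≗ (λ m → trans (⟦∧⟧ (inside t m p) (inside t m q)) (cong₂ _*_ (⟦inside⟧≡δ t p m) (⟦inside⟧≡δ t q m))) ⟩
      sum (λ m → δ (block-index t p) m * δ (block-index t q) m)
        ≡⟨ sum-δδ (block-index t p) (block-index t q) ⟩
      δ (block-index t p) (block-index t q) ∎

  resolution : Resolution v k lam (length classes) (v / k)
  resolution = record
    { block       = λ t p → subst Fin (class-length t) (block-index t p)
    ; block-size  = λ t m → trans (sum-cong-≗ (λ p → δ-subst (class-length t) (block-index t p) m))
                                  (fibre t (subst Fin (sym (class-length t)) m))
    ; concurrence = λ p q p≢q → begin
        sum (λ t → δ (subst Fin (class-length t) (block-index t p)) (subst Fin (class-length t) (block-index t q)))
          ≡⟨ sum-cong-≗ (λ t → trans (δ-subst₂ (class-length t) _ _) (sym (pairs-in-class t p q))) ⟩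
        sum (λ t → countᵇ (λ B → Vec.lookup B p ∧ Vec.lookup B q) (class t))
          ≡⟨ countᵇ-concat (λ B → Vec.lookup B p ∧ Vec.lookup B q) classes ⟨
        countᵇ (λ B → Vec.lookup B p ∧ Vec.lookup B q) (concat classes)
          ≡⟨ countᵇ-↭ (λ B → Vec.lookup B p ∧ Vec.lookup B q) (proj₁ (proj₂ res)) ⟩
        pairCount (blocks D) p q
          ≡⟨ balanced D p q p≢q ⟩
        lam ∎
    }

-- The cyclic construction

module Cyclic-construction {v k lam r n : ℕ} (R : Resolution v k lam r n)
                           (r≡1+nλ : r ≡ suc (n * lam)) (k+λ≡r : k + lam ≡ r) where
  open Resolution R
  open Affine R r≡1+nλ k+λ≡r

  -- "class zero" is empty; class suc t is the t-th parallel class.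
  together : Fin (suc r) → Fin v → Fin v → Bool
  together zero    p a = false
  together (suc t) p a = does (block t p ≟ block t a)

  colour : Fin (suc r * v) → Fin (suc r)
  colour x = proj₁ (remQuot {suc r} v x)

  base : Fin (suc r * v) → Fin v
  base x = proj₂ (remQuot {suc r} v x)

  -- On colour i, the block (j , p) is the block through p of class i ⊖ j; it misses colour j.
  member : Fin (suc r) → Fin v → Fin (suc r * v) → Bool
  member j p x = together (colour x ⊖ j) p (base x)

  cyclic-block : Fin (suc r) → Fin v → Subset (suc r * v)
  cyclic-block j p = Vec.tabulate (member j p)

  cyclic-blocks : List (Subset (suc r * v))
  cyclic-blocks = concat (List.tabulate λ j → List.tabulate (cyclic-block j))

  sum-points : (f : Fin (suc r) → Fin v → ℕ) → sum (λ x → f (colour x) (base x)) ≡ sum (λ i → sum (λ a → f i a))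
  sum-points f = trans (sum-combine {suc r} (λ x → f (colour x) (base x)))
                       (sum-cong-≗ (λ i → sum-cong-≗ (λ a → cong (uncurry f) (remQuot-combine i a))))

  sum-together : ∀ i j p → sum (λ a → ⟦ together (i ⊖ j) p a ⟧) ≡ δᶜ i j * k
  sum-together i j p with i ⊖ j in i⊖j≡s
  ... | zero  = begin
    sum {v} (λ _ → 0)  ≡⟨ sum-const v 0 ⟩
    v * 0              ≡⟨ *-zeroʳ v ⟩
    0                  ≡⟨ cong (_* k) (δᶜ-≡ (⊖≡zero⇒≡ {i = i} {j} i⊖j≡s)) ⟨
    δᶜ i j * k         ∎
  ... | suc t = begin
    sum (λ a → δ (block t p) (block t a))  ≡⟨ sum-cong-≗ (λ a → δ-sym (block t p) (block t a)) ⟩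
    sum (λ a → δ (block t a) (block t p))  ≡⟨ block-size t (block t p) ⟩
    k                                      ≡⟨ +-identityʳ k ⟨
    1 * k                                  ≡⟨ cong (_* k) (δᶜ-≢ i≢j) ⟨
    δᶜ i j * k                             ∎
    where
    i≢j : i ≢ j
    i≢j refl = Finₚ.0≢1+n (trans (sym (⊖-self i)) i⊖j≡s)

  ∣cyclic-block∣ : ∀ j p → ∣ cyclic-block j p ∣ ≡ r * k
  ∣cyclic-block∣ j p = begin
    ∣ cyclic-block j p ∣                                   ≡⟨ ∣∣≡sum (cyclic-block j p) ⟩
    sum (λ x → ⟦ Vec.lookup (cyclic-block j p) x ⟧)
      ≡⟨ sum-cong-≗ (λ x → cong ⟦_⟧ (lookup∘tabulate (member j p) x)) ⟩
    sum (λ x → ⟦ member j p x ⟧)                           ≡⟨ sum-points (λ i a → ⟦ together (i ⊖ j) p a ⟧) ⟩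
    sum (λ i → sum (λ a → ⟦ together (i ⊖ j) p a ⟧))      ≡⟨ sum-cong-≗ (λ i → sum-together i j p) ⟩
    sum (λ i → δᶜ i j * k)                                 ≡⟨ sum-*ʳ k (λ i → δᶜ i j) ⟩
    sum (λ i → δᶜ i j) * k                                 ≡⟨ cong (_* k) (suc-injective (suc-sum-δᶜ j)) ⟩
    r * k                                                  ∎

  colourCount-cyclic-block : ∀ j p i → colourCount colour (cyclic-block j p) i ≡ δᶜ i j * k
  colourCount-cyclic-block j p i = begin
    ∣ cyclic-block j p ∩ colourClass colour i ∣
      ≡⟨ ∣∣≡sum (cyclic-block j p ∩ colourClass colour i) ⟩
    sum (λ x → ⟦ Vec.lookup (cyclic-block j p ∩ colourClass colour i) x ⟧)
      ≡⟨ sum-cong-≗ (λ x → trans (cong ⟦_⟧ (lookup-∩ x)) (⟦∧⟧ (member j p x) _)) ⟩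
    sum (λ x → ⟦ member j p x ⟧ * δ (colour x) i)
      ≡⟨ sum-points (λ i' a → ⟦ together (i' ⊖ j) p a ⟧ * δ i' i) ⟩
    sum (λ i' → sum (λ a → ⟦ together (i' ⊖ j) p a ⟧ * δ i' i))
      ≡⟨ sum-cong-≗ (λ i' → trans (sum-*ʳ (δ i' i) (λ a → ⟦ together (i' ⊖ j) p a ⟧))
                                  (*-comm (sum (λ a → ⟦ together (i' ⊖ j) p a ⟧)) (δ i' i))) ⟩
    sum (λ i' → δ i' i * sum (λ a → ⟦ together (i' ⊖ j) p a ⟧))
      ≡⟨ sum-δ i (λ i' → sum (λ a → ⟦ together (i' ⊖ j) p a ⟧)) ⟩
    sum (λ a → ⟦ together (i ⊖ j) p a ⟧)
      ≡⟨ sum-together i j p ⟩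
    δᶜ i j * k ∎
    where
    lookup-∩ : ∀ x → Vec.lookup (cyclic-block j p ∩ colourClass colour i) x ≡ (member j p x ∧ does (colour x ≟ i))
    lookup-∩ x = begin
      Vec.lookup (cyclic-block j p ∩ colourClass colour i) x
        ≡⟨ lookup-zipWith _∧_ x (cyclic-block j p) (colourClass colour i) ⟩
      Vec.lookup (cyclic-block j p) x ∧ Vec.lookup (colourClass colour i) x
        ≡⟨ cong₂ _∧_ (lookup∘tabulate (member j p) x) (lookup∘tabulate (λ y → ⌊ colour y ≟ i ⌋) x) ⟩
      member j p x ∧ ⌊ colour x ≟ i ⌋
        ≡⟨ cong (member j p x ∧_) (isYes≗does (colour x ≟ i)) ⟩
      member j p x ∧ does (colour x ≟ i) ∎

  same-colour-pairs : ∀ i a b → a ≢ b →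
    sum (λ j → sum (λ p → ⟦ together (i ⊖ j) p a ∧ together (i ⊖ j) p b ⟧)) ≡ lam * k
  same-colour-pairs i a b a≢b = begin
    sum (λ j → h (i ⊖ j))                                   ≡⟨ sum-involution (i ⊖_) (⊖-involutive i) h ⟩
    sum h                                                   ≡⟨⟩
    h zero + sum (λ t → h (suc t))                          ≡⟨ cong (h zero +_) (sum-cong-≗ in-class) ⟩
    sum {v} (λ _ → 0) + sum {r} (λ t → δ (block t a) (block t b) * k)
      ≡⟨ cong₂ _+_ (trans (sum-const v 0) (*-zeroʳ v)) (sum-*ʳ k (λ t → δ (block t a) (block t b))) ⟩
    sum (λ t → δ (block t a) (block t b)) * k               ≡⟨ cong (_* k) (concurrence a b a≢b) ⟩
    lam * k                                                 ∎
    where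
    h : Fin (suc r) → ℕ
    h s = sum (λ p → ⟦ together s p a ∧ together s p b ⟧)
    in-class : ∀ t → h (suc t) ≡ δ (block t a) (block t b) * k
    in-class t = trans (sum-cong-≗ (λ p → ⟦∧⟧ (together (suc t) p a) _)) (meet-self t (block t a) (block t b))

  different-colour-pairs : ∀ i i' a b → i ≢ i' →
    sum (λ j → sum (λ p → ⟦ together (i ⊖ j) p a ∧ together (i' ⊖ j) p b ⟧)) ≡ lam * k
  different-colour-pairs i i' a b i≢i' = *-cancelˡ-≡ _ (lam * k) n {{n≢0}} (begin
    n * sum g                           ≡⟨ sum-*ˡ n g ⟨
    sum (λ j → n * g j)                 ≡⟨ sum-cong-≗ scaled ⟩
    sum (λ j → δᶜ j i * δᶜ j i' * k)    ≡⟨ sum-*ʳ k (λ j → δᶜ j i * δᶜ j i') ⟩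
    sum (λ j → δᶜ j i * δᶜ j i') * k    ≡⟨ cong (_* k) other-colours ⟩
    n * lam * k                         ≡⟨ *-assoc n lam k ⟩
    n * (lam * k)                       ∎)
    where
    n≢0 : NonZero n
    n≢0 = nonZeroIndex (block (subst Fin (sym r≡1+nλ) zero) a)
    g : Fin (suc r) → ℕ
    g j = sum (λ p → ⟦ together (i ⊖ j) p a ∧ together (i' ⊖ j) p b ⟧)
    other-colours : sum (λ j → δᶜ j i * δᶜ j i') ≡ n * lam
    other-colours = suc-injective (begin
      suc (sum (λ j → δᶜ j i * δᶜ j i'))          ≡⟨ cong (_+ sum (λ j → δᶜ j i * δᶜ j i')) (δᶜ-≢ i≢i') ⟨
      δᶜ i i' + sum (λ j → δᶜ j i * δᶜ j i')      ≡⟨ sum-split i (λ j → δᶜ j i') ⟨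
      sum (λ j → δᶜ j i')                         ≡⟨ suc-injective (suc-sum-δᶜ i') ⟩
      r                                           ≡⟨ r≡1+nλ ⟩
      suc (n * lam)                               ∎)
    n*sum0 : n * sum {v} (λ _ → 0) ≡ 0
    n*sum0 = trans (cong (n *_) (trans (sum-const v 0) (*-zeroʳ v))) (*-zeroʳ n)
    scaled : ∀ j → n * sum (λ p → ⟦ together (i ⊖ j) p a ∧ together (i' ⊖ j) p b ⟧) ≡ δᶜ j i * δᶜ j i' * k
    scaled j with i ⊖ j in i⊖j≡s | i' ⊖ j in i'⊖j≡s'
    ... | zero  | _ = begin
      n * sum {v} (λ _ → 0)   ≡⟨ n*sum0 ⟩
      0                       ≡⟨ cong (λ d → d * δᶜ j i' * k) (δᶜ-≡ (sym (⊖≡zero⇒≡ {i = i} {j} i⊖j≡s))) ⟨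
      δᶜ j i * δᶜ j i' * k    ∎
    ... | suc t | zero = begin
      n * sum (λ p → ⟦ together (suc t) p a ∧ false ⟧)
        ≡⟨ cong (n *_) (sum-cong-≗ (λ p → cong ⟦_⟧ (∧-zeroʳ (together (suc t) p a)))) ⟩
      n * sum {v} (λ _ → 0)                               ≡⟨ n*sum0 ⟩
      0                                                   ≡⟨ cong (_* k) (*-zeroʳ (δᶜ j i)) ⟨
      δᶜ j i * 0 * k
        ≡⟨ cong (λ d → δᶜ j i * d * k) (δᶜ-≡ (sym (⊖≡zero⇒≡ {i = i'} {j} i'⊖j≡s'))) ⟨
      δᶜ j i * δᶜ j i' * k                                ∎
    ... | suc t | suc t' = begin
      n * sum (λ p → ⟦ together (suc t) p a ∧ together (suc t') p b ⟧)
        ≡⟨ cong (n *_) (sum-cong-≗ (λ p → ⟦∧⟧ (together (suc t) p a) _)) ⟩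
      n * meet t (block t a) t' (block t' b)
        ≡⟨ affine-intersection t (block t a) t' (block t' b) t'≢t ⟩
      k
        ≡⟨ +-identityʳ k ⟨
      1 * 1 * k
        ≡⟨ cong₂ (λ d d' → d * d' * k) (δᶜ-≢ j≢i) (δᶜ-≢ j≢i') ⟨
      δᶜ j i * δᶜ j i' * k ∎
      where
      t'≢t : t' ≢ t
      t'≢t refl = i≢i' (⊖-injectiveˡ {j = j} (trans i⊖j≡s (sym i'⊖j≡s')))
      j≢i : j ≢ i
      j≢i refl = Finₚ.0≢1+n (trans (sym (⊖-self j)) i⊖j≡s)
      j≢i' : j ≢ i'
      j≢i' refl = Finₚ.0≢1+n (trans (sym (⊖-self j)) i'⊖j≡s')

  pairCount-cyclic-blocks : ∀ x y → x ≢ y → pairCount cyclic-blocks x y ≡ lam * k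
  pairCount-cyclic-blocks x y x≢y = begin
    pairCount cyclic-blocks x y
      ≡⟨ countᵇ-concat-tabulate P (λ j → List.tabulate (cyclic-block j)) ⟩
    sum (λ j → countᵇ P (List.tabulate (cyclic-block j)))
      ≡⟨ sum-cong-≗ (λ j → countᵇ-tabulate P (cyclic-block j)) ⟩
    sum (λ j → sum (λ p → ⟦ P (cyclic-block j p) ⟧))
      ≡⟨ sum-cong-≗ (λ j → sum-cong-≗ (λ p → cong₂ (λ u w → ⟦ u ∧ w ⟧)
           (lookup∘tabulate (member j p) x) (lookup∘tabulate (member j p) y))) ⟩
    sum (λ j → sum (λ p → ⟦ member j p x ∧ member j p y ⟧))
      ≡⟨ by-colour (colour x ≟ colour y) ⟩
    lam * k ∎
    where
    P : Subset (suc r * v) → Bool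
    P B = Vec.lookup B x ∧ Vec.lookup B y
    by-colour : Dec (colour x ≡ colour y) → sum (λ j → sum (λ p → ⟦ member j p x ∧ member j p y ⟧)) ≡ lam * k
    by-colour (yes same) rewrite same = same-colour-pairs (colour y) (base x) (base y) base≢
      where
      base≢ : base x ≢ base y
      base≢ b≡b = x≢y (trans (sym (combine-remQuot {suc r} v x))
                      (trans (cong₂ combine same b≡b) (combine-remQuot {suc r} v y)))
    by-colour (no different) = different-colour-pairs (colour x) (colour y) (base x) (base y) different

  module Design (2≤k : 2 ≤ k) (k<v : k < v) (1≤lam : 1 ≤ lam)
           {K : ℕ} (k*r≡K : k * r ≡ K) {Λ c : ℕ} (Λ≡c*λk : Λ ≡ c * (lam * k)) (1≤c : 1 ≤ c) where

    copies : List (Subset (suc r * v))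
    copies = concat (List.tabulate {n = c} λ _ → cyclic-blocks)

    private
      1≤v : 1 ≤ v
      1≤v = ≤-trans (≤-trans (s≤s z≤n) 2≤k) (<⇒≤ k<v)
      instance
        r≢0 : NonZero r
        r≢0 = subst NonZero (sym r≡1+nλ) _

      ∣cyclic-block∣≡K : ∀ j p → ∣ cyclic-block j p ∣ ≡ K
      ∣cyclic-block∣≡K j p = trans (∣cyclic-block∣ j p) (trans (*-comm r k) k*r≡K)

      all-copies : ∀ {P : Subset (suc r * v) → Set} → (∀ j p → P (cyclic-block j p)) → All P copies
      all-copies P-block = concat⁺ (tabulate⁺ {n = c} λ _ → concat⁺ (tabulate⁺ λ j → tabulate⁺ (P-block j)))

    cyclic-design : BIBD (suc r * v) K Λ
    cyclic-design = record
      { blocks    = copies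
      ; v-pos     = ≤-trans 1≤v (m≤m+n v (r * v))
      ; lam-pos   = subst (1 ≤_) (sym Λ≡c*λk) (*-mono-≤ 1≤c (*-mono-≤ 1≤lam (≤-trans (s≤s z≤n) 2≤k)))
      ; k≥2       = subst (2 ≤_) k*r≡K (≤-trans 2≤k (m≤m*n k r))
      ; k<v       = subst (_< suc r * v) k*r≡K
                      (≤-<-trans (*-monoˡ-≤ r (<⇒≤ k<v)) (subst (_< v + r * v) (*-comm r v) (m<n+m (r * v) 1≤v)))
      ; blockSize = all-copies ∣cyclic-block∣≡K
      ; balanced  = λ x y x≢y → begin
          pairCount copies x y
            ≡⟨ countᵇ-concat-tabulate (λ B → Vec.lookup B x ∧ Vec.lookup B y) {c} (λ _ → cyclic-blocks) ⟩
          sum {c} (λ _ → pairCount cyclic-blocks x y) ≡⟨ sum-cong-≗ {c} (λ _ → pairCount-cyclic-blocks x y x≢y) ⟩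
          sum {c} (λ _ → lam * k)                  ≡⟨ sum-const c (lam * k) ⟩
          c * (lam * k)                            ≡⟨ Λ≡c*λk ⟨
          Λ                                        ∎
      }

    cyclic-design-ZeroULSE : ZeroULSE (suc r) cyclic-design colour
    cyclic-design-ZeroULSE = surjective , divides k (sym k*r≡K) , all-copies missing-colour
      where
      a₀ : Fin v
      a₀ = Fin.fromℕ< 1≤v
      surjective : IsColouring colour
      surjective i = combine i a₀ , λ {x} x≡ → trans (cong colour x≡) (cong proj₁ (remQuot-combine i a₀))
      missing-colour : ∀ j p → Σ (Fin (suc r)) λ j' → (colourCount colour (cyclic-block j p) j' ≡ 0) ×
                         ((i : Fin (suc r)) → i ≢ j' → colourCount colour (cyclic-block j p) i * r ≡ K)
      missing-colour j p = j , trans (colourCount-cyclic-block j p j) (cong (_* k) (δᶜ-≡ {i = j} refl))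
        , λ i i≢j → begin
            colourCount colour (cyclic-block j p) i * r  ≡⟨ cong (_* r) (colourCount-cyclic-block j p i) ⟩
            δᶜ i j * k * r                               ≡⟨ cong (λ d → d * k * r) (δᶜ-≢ i≢j) ⟩
            1 * k * r                                    ≡⟨ cong (_* r) (*-identityˡ k) ⟩
            k * r                                        ≡⟨ k*r≡K ⟩
            K                                            ∎

    length-copies : length copies ≡ c * (suc r * v)
    length-copies = begin
      length copies                               ≡⟨ length-concat-tabulate {n = c} (λ _ → cyclic-blocks) ⟩
      sum {c} (λ _ → length cyclic-blocks)        ≡⟨ sum-const c (length cyclic-blocks) ⟩
      c * length cyclic-blocks                    ≡⟨ cong (c *_) (length-concat-tabulate (λ j → List.tabulate (cyclic-block j))) ⟩
      c * sum (λ j → length (List.tabulate (cyclic-block j)))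
                                                  ≡⟨ cong (c *_) (sum-cong-≗ (λ j → length-tabulate (cyclic-block j))) ⟩
      c * sum {suc r} (λ _ → v)                   ≡⟨ cong (c *_) (sum-const (suc r) v) ⟩
      c * (suc r * v)                             ∎

module Parameters {L' k v₀ k₀ lam₀ : ℕ} (1≤λ₀ : 1 ≤ lam₀)
  (v₀[L²-k]≡L'k : v₀ * (suc L' ^ 2 ∸ k) ≡ L' * k)
  (k₀L≡k : k₀ * suc L' ≡ k)
  (λ₀L≡L²-k : lam₀ * suc L' ≡ suc L' ^ 2 ∸ k) where

  private
    L = suc L'

  k[L²-k]≡λ₀k₀L² : k * (L ^ 2 ∸ k) ≡ lam₀ * k₀ * L ^ 2
  k[L²-k]≡λ₀k₀L² = trans (cong₂ _*_ (sym k₀L≡k) (sym λ₀L≡L²-k)) (regroup k₀ lam₀ L)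
    where
    regroup : ∀ k₀ λ₀ L → k₀ * L * (λ₀ * L) ≡ λ₀ * k₀ * (L * (L * 1))
    regroup = solve-∀

  λ≡m*λ₀k₀ : ∀ lam m → lam * L ^ 2 ≡ m * (k * (L ^ 2 ∸ k)) → lam ≡ m * (lam₀ * k₀)
  λ≡m*λ₀k₀ lam m λL²≡ =
    *-cancelʳ-≡ lam _ (L ^ 2) (trans λL²≡ (trans (cong (m *_) k[L²-k]≡λ₀k₀L²) (sym (*-assoc m (lam₀ * k₀) (L ^ 2)))))

  k₀+λ₀≡L : k₀ + lam₀ ≡ L
  k₀+λ₀≡L = *-cancelʳ-≡ (k₀ + lam₀) L L (begin
    (k₀ + lam₀) * L        ≡⟨ *-distribʳ-+ L k₀ lam₀ ⟩
    k₀ * L + lam₀ * L      ≡⟨ cong₂ _+_ k₀L≡k λ₀L≡L²-k ⟩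
    k + (L ^ 2 ∸ k)        ≡⟨ m+[n∸m]≡n k≤L² ⟩
    L ^ 2                  ≡⟨ cong (L *_) (*-identityʳ L) ⟩
    L * L                  ∎)
    where
    k≤L² : k ≤ L ^ 2
    k≤L² = <⇒≤ (m∸n≢0⇒n<m λ L²-k≡0 →
             <⇒≱ 1≤λ₀ (≤-reflexive (*-cancelʳ-≡ lam₀ 0 L (trans λ₀L≡L²-k L²-k≡0))))

  v₀λ₀≡L'k₀ : v₀ * lam₀ ≡ L' * k₀
  v₀λ₀≡L'k₀ = *-cancelʳ-≡ (v₀ * lam₀) (L' * k₀) L (begin
    v₀ * lam₀ * L      ≡⟨ *-assoc v₀ lam₀ L ⟩
    v₀ * (lam₀ * L)    ≡⟨ cong (v₀ *_) λ₀L≡L²-k ⟩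
    v₀ * (L ^ 2 ∸ k)   ≡⟨ v₀[L²-k]≡L'k ⟩
    L' * k             ≡⟨ cong (L' *_) k₀L≡k ⟨
    L' * (k₀ * L)      ≡⟨ *-assoc L' k₀ L ⟨
    L' * k₀ * L        ∎)

  replication≡L : ∀ r → 2 ≤ k₀ → r * k₀ + lam₀ ≡ r + v₀ * lam₀ → r ≡ L
  replication≡L r (s≤s (s≤s {n = k₂} _)) replication =
    *-cancelʳ-≡ r L k₁ (+-cancelʳ-≡ lam₀ _ _ (+-cancelˡ-≡ r _ _ (begin
      r + (r * k₁ + lam₀)           ≡⟨ expand r k₁ lam₀ ⟩
      r * k₀ + lam₀                 ≡⟨ replication ⟩
      r + v₀ * lam₀                 ≡⟨ cong (r +_) v₀λ₀≡L'k₀ ⟩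
      r + L' * suc k₁               ≡⟨ cong (r +_) (*-suc L' k₁) ⟩
      r + (L' + L' * k₁)            ≡⟨ cong (λ a → r + (a + L' * k₁)) L'≡k₁+λ₀ ⟩
      r + ((k₁ + lam₀) + L' * k₁)   ≡⟨ cong (r +_) (collect k₁ lam₀ L') ⟩
      r + (L * k₁ + lam₀)           ∎)))
    where
    k₁ = suc k₂
    L'≡k₁+λ₀ : L' ≡ k₁ + lam₀
    L'≡k₁+λ₀ = suc-injective (sym k₀+λ₀≡L)
    expand : ∀ r k₁ l → r + (r * k₁ + l) ≡ r * suc k₁ + l
    expand = solve-∀
    collect : ∀ k₁ l L' → (k₁ + l) + L' * k₁ ≡ suc L' * k₁ + l
    collect = solve-∀

  n*λ₀≡L' : ∀ n → n * k₀ ≡ v₀ → 2 ≤ k₀ → n * lam₀ ≡ L'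
  n*λ₀≡L' n nk₀≡v₀ (s≤s (s≤s _)) = *-cancelʳ-≡ (n * lam₀) L' k₀ (begin
    n * lam₀ * k₀     ≡⟨ *-assoc n lam₀ k₀ ⟩
    n * (lam₀ * k₀)   ≡⟨ cong (n *_) (*-comm lam₀ k₀) ⟩
    n * (k₀ * lam₀)   ≡⟨ *-assoc n k₀ lam₀ ⟨
    n * k₀ * lam₀     ≡⟨ cong (_* lam₀) nk₀≡v₀ ⟩
    v₀ * lam₀         ≡⟨ v₀λ₀≡L'k₀ ⟩
    L' * k₀           ∎)

theorem4p6 : (k ℓ : ℕ) → 1 ≤ k → 1 ≤ ℓ →
  (v₀ k₀ lam₀ : ℕ) →
  v₀ * ((ℓ ∸ 1) ^ 2 ∸ k) ≡ (ℓ ∸ 2) * k →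
  k₀ * (ℓ ∸ 1) ≡ k →
  lam₀ * (ℓ ∸ 1) ≡ (ℓ ∸ 1) ^ 2 ∸ k →
  Σ (BIBD v₀ k₀ lam₀) Resolvable →
  ((lam m : ℕ) → 1 ≤ m →
    lam * (ℓ ∸ 1) ^ 2 ≡ m * (k * ((ℓ ∸ 1) ^ 2 ∸ k)) →
    Σ ℕ λ v → (v * ((ℓ ∸ 1) ^ 2 ∸ k) ≡ ℓ * (ℓ ∸ 2) * k) ×
      Σ (BIBD v k lam) λ D → Σ (Fin v → Fin ℓ) λ c → ZeroULSE ℓ D c)
  ×
  (Σ ℕ λ v → (v * ((ℓ ∸ 1) ^ 2 ∸ k) ≡ ℓ * (ℓ ∸ 2) * k) ×
    Σ ℕ λ lam → (lam * (ℓ ∸ 1) ^ 2 ≡ k * ((ℓ ∸ 1) ^ 2 ∸ k)) ×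
      Σ (BIBD v k lam) λ D → Symmetric D ×
        Σ (Fin v → Fin ℓ) λ c → ZeroULSE ℓ D c)
theorem4p6 k zero _ ()
theorem4p6 k (suc zero) 1≤k _ v₀ k₀ _ _ k₀*0≡k _ _ = contradiction (subst (1 ≤_) (trans (sym k₀*0≡k) (*-zeroʳ k₀)) 1≤k) λ ()
theorem4p6 k ℓ@(suc (suc L')) _ _ v₀ k₀ lam₀ v₀[L²-k]≡L'k k₀L≡k λ₀L≡L²-k (D , res) =
  (λ lam m 1≤m λL²≡ → let λ≡mλ₀k₀ = λ≡m*λ₀k₀ lam m λL²≡ in
     ℓ * v₀ , v≡ , cyclic-design λ≡mλ₀k₀ 1≤m , colour , cyclic-design-ZeroULSE λ≡mλ₀k₀ 1≤m) ,
  (ℓ * v₀ , v≡ , lam₀ * k₀ , sym k[L²-k]≡λ₀k₀L² , cyclic-design λ₀k₀≡1*λ₀k₀ ≤-refl ,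
   trans (length-copies λ₀k₀≡1*λ₀k₀ ≤-refl) (+-identityʳ (ℓ * v₀)) ,
   colour , cyclic-design-ZeroULSE λ₀k₀≡1*λ₀k₀ ≤-refl)
  where
  open Parameters {L'} {k} {v₀} {k₀} {lam₀} (lam-pos D) v₀[L²-k]≡L'k k₀L≡k λ₀L≡L²-k
  instance
    k₀≢0 : NonZero k₀
    k₀≢0 = >-nonZero (≤-trans (s≤s z≤n) (k≥2 D))
  p₀ : Fin v₀
  p₀ = Fin.fromℕ< (≤-trans (s≤s z≤n) (k<v D))
  classes≡L : length (proj₁ res) ≡ suc L'
  classes≡L = replication≡L _ (k≥2 D) (Resolution-properties.replication (resolution D res) p₀)
  R : Resolution v₀ k₀ lam₀ (suc L') (v₀ / k₀)
  R = subst (λ r → Resolution v₀ k₀ lam₀ r (v₀ / k₀)) classes≡L (resolution D res)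
  nλ₀≡L' : v₀ / k₀ * lam₀ ≡ L'
  nλ₀≡L' = n*λ₀≡L' (v₀ / k₀) (Resolution-properties.class-size R zero) (k≥2 D)
  open Cyclic-construction R (cong suc (sym nλ₀≡L')) k₀+λ₀≡L
  open Design (k≥2 D) (k<v D) (lam-pos D) k₀L≡k
  v≡ : ℓ * v₀ * (suc L' ^ 2 ∸ k) ≡ ℓ * L' * k
  v≡ = trans (*-assoc ℓ v₀ _) (trans (cong (ℓ *_) v₀[L²-k]≡L'k) (sym (*-assoc ℓ L' k)))
  λ₀k₀≡1*λ₀k₀ : lam₀ * k₀ ≡ 1 * (lam₀ * k₀)
  λ₀k₀≡1*λ₀k₀ = sym (*-identityˡ (lam₀ * k₀))
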